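{- For every $n\ge-1$, $$\mathrm{con}(\mathrm{cad}^+[n])=\mathrm{cad}[n]=\mathrm{cad}^+[n]\boxplus\mathbf{c}=\mathrm{cad}^+[n]\cdot R(\mathbf{c}),$$ and therefore $\mathrm{cad}=\mathrm{cad}^+\cdot R(\mathbf{c})$.
   Context: $[n]=\{0,\dots,n\}$ for $n\ge0$, $[-1]=\emptyset$. For $n,p\ge-1$: $\mathrm{cad}^+[n]_p$ is the number of chains of subsets $\emptyset=N_{ -1}\subsetneq N_0\subsetneq\cdots\subsetneq N_p\subseteq[n]$; $\mathrm{cad}[n]_p$ is the number of chains $\emptyset=N_{ -1}\subseteq N_0\subsetneq N_1\subsetneq\cdots\subsetneq N_p\subseteq[n]$ (only $N_0=\emptyset$ is allowed to repeat $N_{ -1}$). $\mathrm{cad}^+[n]$, $\mathrm{cad}[n]$ are the sequences $(\cdot_p)_{p\ge-1}$ and $\mathrm{cad}^+$, $\mathrm{cad}$ the matrices with rows $\mathrm{cad}^+[n]$, $\mathrm{cad}[n]$. For sequences indexed by $\{ -1,0,1,\dots\}$: $\mathrm{con}(c)_{ -1}=c_{ -1}$, $\mathrm{con}(c)_i=c_i+c_{i-1}$ for $i\ge0$; join $(a\boxplus b)_m=\sum_{p+q=m-1,\ p,q\ge-1}a_pb_q$; $\mathbf{c}=(1,1,0,0,\dots)$ (i.e. $\mathbf{c}_{ -1}=\mathbf{c}_0=1$, else $0$); $R(b)$ is the matrix with $R(b)_{i,j}=b_{j-i-1}$ if $j-i-1\ge-1$ and $0$ otherwise ($i,j\ge-1$);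 $(a\cdot B)_j=\sum_ka_kB_{k,j}$. -}

module Defs where

open import Data.Nat using (ℕ; zero; suc; _+_; _*_; _∸_; _≤?_)
open import Data.Bool using (Bool; true; false)
open import Data.List using (List; []; _∷_; [_]; map; concatMap; _++_; length; filter)
open import Data.Vec using ([]; _∷_)
open import Data.Product using (_×_; _,_)
open import Data.Unit using (⊤; tt)
open import Data.Fin.Subset using (Subset; _⊆_; _⊂_; outside; inside) renaming (⊥ to ∅)
open import Data.Fin.Subset.Properties using (_⊆?_; _⊂?_)
open import Relation.Nullary using (Dec; yes; no)
open import Relation.Nullary.Decidable using (_×-dec_)

-- Index conventions.
-- [n] = {0,…,n} (n ≥ -1) is represented by Fin k with k = n + 1,
-- subsets of [n] by Subset k.
-- Sequences indexed by {-1,0,1,…} are represented by functions ℕ → ℕ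
-- where argument i stands for the index i - 1.
-- Matrices indexed by {-1,0,…}² likewise by ℕ → ℕ → ℕ.

Seq : Set
Seq = ℕ → ℕ

Mat : Set
Mat = ℕ → ℕ → ℕ

subsets : (k : ℕ) → List (Subset k)
subsets zero    = [ [] ]
subsets (suc k) = map (outside ∷_) (subsets k) ++ map (inside ∷_) (subsets k)

tuples : (k q : ℕ) → List (List (Subset k))
tuples k zero    = [ [] ]
tuples k (suc q) = concatMap (λ s → map (s ∷_) (tuples k q)) (subsets k)

StrictFrom : {k : ℕ} → Subset k → List (Subset k) → Set
StrictFrom prev []       = ⊤
StrictFrom prev (N ∷ Ns) = prev ⊂ N × StrictFrom N Ns

strictFrom? : {k : ℕ} → (prev : Subset k) → (Ns : List (Subset k)) → Dec (StrictFrom prev Ns)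
strictFrom? prev []       = yes tt
strictFrom? prev (N ∷ Ns) = (prev ⊂? N) ×-dec strictFrom? N Ns

PlusChain : {k : ℕ} → List (Subset k) → Set
PlusChain Ns = StrictFrom ∅ Ns

plusChain? : {k : ℕ} → (Ns : List (Subset k)) → Dec (PlusChain Ns)
plusChain? Ns = strictFrom? ∅ Ns

Chain : {k : ℕ} → List (Subset k) → Set
Chain []       = ⊤
Chain (N ∷ Ns) = ∅ ⊆ N × StrictFrom N Ns

chain? : {k : ℕ} → (Ns : List (Subset k)) → Dec (Chain Ns)
chain? []       = yes tt
chain? (N ∷ Ns) = (∅ ⊆? N) ×-dec strictFrom? N Ns

-- cad⁺ k q = cad⁺[k-1]_{q-1}  (number of chains of p+1 = q sets)
cad⁺ : Mat
cad⁺ k q = length (filter plusChain? (tuples k q))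

-- cad k q = cad[k-1]_{q-1}
cad : Mat
cad k q = length (filter chain? (tuples k q))

sumTo : ℕ → (ℕ → ℕ) → ℕ
sumTo zero    f = f 0
sumTo (suc m) f = sumTo m f + f (suc m)

con : Seq → Seq
con c zero    = c zero
con c (suc i) = c (suc i) + c i

-- (a ⊞ b)_m = Σ_{p+q=m-1, p,q ≥ -1} a_p b_q ; shifted: Σ_{p'+q'=m'} a p' * b q'
_⊞_ : Seq → Seq → Seq
(a ⊞ b) m = sumTo m (λ i → a i * b (m ∸ i))

𝐜 : Seq
𝐜 0 = 1
𝐜 1 = 1
𝐜 (suc (suc _)) = 0

-- R(b)_{i,j} = b_{j-i-1} if j-i-1 ≥ -1, else 0; shifted: b (j' - i') if i' ≤ j'
R : Seq → Mat
R b i j with i ≤? j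
... | yes _ = b (j ∸ i)
... | no  _ = 0

-- (a · B)_j = Σ_k a_k B_{k,j}.  For upper-triangular B (such as R(b)),
-- B_{k,j} = 0 whenever k > j, so the sum is the finite sum over k ≤ j.
_·_ : Seq → Mat → Seq
(a · B) j = sumTo j (λ k → a k * B k j)

_·ₘ_ : Mat → Mat → Mat
(M ·ₘ B) n = M n · B

{-# OPTIONS --safe #-}
-- Every strict chain N₀ ⊊ … ⊊ N_p is a cad-chain, and it is a cad⁺-chain exactly when N₀ ≠ ∅.
-- So the cad-chains of p + 1 sets split into the cad⁺-chains of p + 1 sets and those with
-- N₀ = ∅, which are the cad⁺-chains N₁ ⊊ … ⊊ N_p of p sets: this is cad = con(cad⁺).
-- Joining with 𝐜 = (1,1,0,…) is exactly con, and multiplying by the upper triangular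
-- Toeplitz matrix R(b) is joining with b.
module Submission where

open import Defs
open import Function using (_∘_)
open import Data.Nat using (ℕ; zero; suc; _+_; _*_; _∸_; _≤_; _<_; _≤?_; s≤s; z≤n)
open import Data.Nat.Properties
  using (+-comm; *-identityʳ; *-zeroʳ; +-∸-assoc; n∸n≡0; ≤-refl; m≤n⇒m≤1+n; <⇒≤; m<n⇒0<n∸m)
open import Data.Bool using (true; false)
open import Data.Product using (_×_; _,_; proj₁; proj₂)
open import Data.List using (List; []; _∷_; map; _++_; length; filter; concatMap)
open import Data.List.Properties using (filter-++; filter-≐; filter-none; length-++; length-map)
open import Data.List.Relation.Unary.All as All using (All; []; _∷_; universal)
open import Data.List.Relation.Unary.All.Properties using (map⁺; ++⁺)
open import Data.Vec using (_∷_; here; there)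
import Data.Fin as Fin
open import Data.Fin.Subset using (Subset; _⊂_; outside; inside) renaming (⊥ to ∅)
open import Data.Fin.Subset.Properties using (⊥⊆; ∉⊥; ⊂-irref)
open import Relation.Nullary using (does; yes; no; contradiction)
open import Relation.Unary using (Pred; Decidable)
open import Relation.Binary.PropositionalEquality using (_≡_; refl; sym; trans; cong; cong₂; module ≡-Reasoning)

open ≡-Reasoning

module _ {p} {A B : Set} {P : Pred A p} (P? : Decidable P) where

  filter-map : (f : B → A) (xs : List B) → filter P? (map f xs) ≡ map f (filter (P? ∘ f) xs)
  filter-map f []       = refl
  filter-map f (x ∷ xs) with does (P? (f x))
  ... | true  = cong (f x ∷_) (filter-map f xs)
  ... | false = filter-map f xs

  length-filter-map : (f : B → A) (xs : List B) →
                      length (filter P? (map f xs)) ≡ length (filter (P? ∘ f) xs)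
  length-filter-map f xs = trans (cong length (filter-map f xs)) (length-map f (filter (P? ∘ f) xs))

module _ {p} {A : Set} {P : Pred A p} (P? : Decidable P) where

  length-filter-++ : (xs ys : List A) →
                     length (filter P? (xs ++ ys)) ≡ length (filter P? xs) + length (filter P? ys)
  length-filter-++ xs ys = trans (cong length (filter-++ P? xs ys)) (length-++ (filter P? xs))

nonemptySubsets : (k : ℕ) → List (Subset k)
nonemptySubsets zero    = []
nonemptySubsets (suc k) = map (outside ∷_) (nonemptySubsets k) ++ map (inside ∷_) (subsets k)

subsets≡∅∷nonemptySubsets : (k : ℕ) → subsets k ≡ ∅ ∷ nonemptySubsets k
subsets≡∅∷nonemptySubsets zero    = refl
subsets≡∅∷nonemptySubsets (suc k) rewrite subsets≡∅∷nonemptySubsets k = refl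

∅⊂outside∷ : {k : ℕ} {s : Subset k} → ∅ ⊂ s → ∅ ⊂ (outside ∷ s)
∅⊂outside∷ (_ , x , x∈s , _) = ⊥⊆ , Fin.suc x , there x∈s , ∉⊥

∅⊂inside∷ : {k : ℕ} {s : Subset k} → ∅ ⊂ (inside ∷ s)
∅⊂inside∷ = ⊥⊆ , Fin.zero , here , ∉⊥

nonemptySubsets-nonempty : (k : ℕ) → All (∅ ⊂_) (nonemptySubsets k)
nonemptySubsets-nonempty zero    = []
nonemptySubsets-nonempty (suc k) =
  ++⁺ (map⁺ (All.map ∅⊂outside∷ (nonemptySubsets-nonempty k)))
      (map⁺ (universal (λ _ → ∅⊂inside∷) (subsets k)))

module _ {k : ℕ} (ts : List (List (Subset k))) where

  chains-from : (s : Subset k) →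
                length (filter chain? (map (s ∷_) ts)) ≡ length (filter (strictFrom? s) ts)
  chains-from s = trans (length-filter-map chain? (s ∷_) ts)
    (cong length (filter-≐ (chain? ∘ (s ∷_)) (strictFrom? s) (proj₂ , (⊥⊆ ,_)) ts))

  plusChains-from : {s : Subset k} → ∅ ⊂ s →
                    length (filter plusChain? (map (s ∷_) ts)) ≡ length (filter (strictFrom? s) ts)
  plusChains-from {s} ∅⊂s = trans (length-filter-map plusChain? (s ∷_) ts)
    (cong length (filter-≐ (plusChain? ∘ (s ∷_)) (strictFrom? s) (proj₂ , (∅⊂s ,_)) ts))

  no-plusChain-from-∅ : filter plusChain? (map (∅ ∷_) ts) ≡ []
  no-plusChain-from-∅ = trans (filter-map plusChain? (∅ ∷_) ts)
    (cong (map (∅ ∷_)) (filter-none (plusChain? ∘ (∅ ∷_)) (universal (λ _ → ⊂-irref refl ∘ proj₁) ts)))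

  chains≡plusChains-from-nonempty : (ss : List (Subset k)) → All (∅ ⊂_) ss →
    length (filter chain? (concatMap (λ s → map (s ∷_) ts) ss))
      ≡ length (filter plusChain? (concatMap (λ s → map (s ∷_) ts) ss))
  chains≡plusChains-from-nonempty []       []           = refl
  chains≡plusChains-from-nonempty (s ∷ ss) (∅⊂s ∷ ∅⊂ss) = begin
    length (filter chain? (map (s ∷_) ts ++ rest))
      ≡⟨ length-filter-++ chain? (map (s ∷_) ts) rest ⟩
    length (filter chain? (map (s ∷_) ts)) + length (filter chain? rest)
      ≡⟨ cong₂ _+_ (trans (chains-from s) (sym (plusChains-from ∅⊂s)))
                   (chains≡plusChains-from-nonempty ss ∅⊂ss) ⟩
    length (filter plusChain? (map (s ∷_) ts)) + length (filter plusChain? rest)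
      ≡⟨ length-filter-++ plusChain? (map (s ∷_) ts) rest ⟨
    length (filter plusChain? (map (s ∷_) ts ++ rest)) ∎
    where rest = concatMap (λ s → map (s ∷_) ts) ss

tuples-suc : (k q : ℕ) → tuples k (suc q) ≡
  map (∅ ∷_) (tuples k q) ++ concatMap (λ s → map (s ∷_) (tuples k q)) (nonemptySubsets k)
tuples-suc k q = cong (concatMap (λ s → map (s ∷_) (tuples k q))) (subsets≡∅∷nonemptySubsets k)

cad-suc : (k q : ℕ) → cad k (suc q) ≡ cad⁺ k (suc q) + cad⁺ k q
cad-suc k q = begin
  cad k (suc q)
    ≡⟨ cong (length ∘ filter chain?) (tuples-suc k q) ⟩
  length (filter chain? (map (∅ ∷_) ts ++ rest))
    ≡⟨ length-filter-++ chain? (map (∅ ∷_) ts) rest ⟩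
  length (filter chain? (map (∅ ∷_) ts)) + length (filter chain? rest)
    ≡⟨ cong₂ _+_ (chains-from ts ∅) (chains≡plusChains-from-nonempty ts (nonemptySubsets k)
                                                                  (nonemptySubsets-nonempty k)) ⟩
  cad⁺ k q + length (filter plusChain? rest)
    ≡⟨ +-comm (cad⁺ k q) _ ⟩
  length (filter plusChain? rest) + cad⁺ k q
    ≡⟨ cong (λ xs → length (xs ++ filter plusChain? rest) + cad⁺ k q) (no-plusChain-from-∅ ts) ⟨
  length (filter plusChain? (map (∅ ∷_) ts) ++ filter plusChain? rest) + cad⁺ k q
    ≡⟨ cong (λ xs → length xs + cad⁺ k q) (filter-++ plusChain? (map (∅ ∷_) ts) rest) ⟨
  length (filter plusChain? (map (∅ ∷_) ts ++ rest)) + cad⁺ k q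
    ≡⟨ cong (λ xs → length (filter plusChain? xs) + cad⁺ k q) (tuples-suc k q) ⟨
  cad⁺ k (suc q) + cad⁺ k q ∎
  where
    ts   = tuples k q
    rest = concatMap (λ s → map (s ∷_) ts) (nonemptySubsets k)

con-cad⁺ : (k q : ℕ) → con (cad⁺ k) q ≡ cad k q
con-cad⁺ k zero    = refl
con-cad⁺ k (suc q) = sym (cad-suc k q)

sumTo-cong : (m : ℕ) {f g : ℕ → ℕ} → (∀ i → i ≤ m → f i ≡ g i) → sumTo m f ≡ sumTo m g
sumTo-cong zero    f≡g = f≡g 0 z≤n
sumTo-cong (suc m) f≡g =
  cong₂ _+_ (sumTo-cong m (λ i i≤m → f≡g i (m≤n⇒m≤1+n i≤m))) (f≡g (suc m) ≤-refl)

sumTo-zero : (m : ℕ) {f : ℕ → ℕ} → (∀ i → i ≤ m → f i ≡ 0) → sumTo m f ≡ 0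
sumTo-zero zero    f≡0 = f≡0 0 z≤n
sumTo-zero (suc m) f≡0 =
  cong₂ _+_ (sumTo-zero m (λ i i≤m → f≡0 i (m≤n⇒m≤1+n i≤m))) (f≡0 (suc m) ≤-refl)

sumTo-last : (m : ℕ) {f : ℕ → ℕ} → (∀ i → i < m → f i ≡ 0) → sumTo m f ≡ f m
sumTo-last zero    _   = refl
sumTo-last (suc m) {f} f≡0 = cong (_+ f (suc m)) (sumTo-zero m (λ i i≤m → f≡0 i (s≤s i≤m)))

𝐜-suc-pos : {n : ℕ} → 0 < n → 𝐜 (suc n) ≡ 0
𝐜-suc-pos (s≤s z≤n) = refl

𝐜-suc-∸ : {i m : ℕ} → i ≤ m → 𝐜 (suc m ∸ i) ≡ 𝐜 (suc (m ∸ i))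
𝐜-suc-∸ i≤m = cong 𝐜 (+-∸-assoc 1 i≤m)

con≗⊞𝐜 : (a : Seq) (m : ℕ) → con a m ≡ (a ⊞ 𝐜) m
con≗⊞𝐜 a zero    = sym (*-identityʳ (a 0))
con≗⊞𝐜 a (suc m) = begin
  a (suc m) + a m
    ≡⟨ +-comm (a (suc m)) (a m) ⟩
  a m + a (suc m)
    ≡⟨ cong₂ _+_ all-but-last (sym (*-identityʳ (a (suc m)))) ⟩
  sumTo m (λ i → a i * 𝐜 (suc m ∸ i)) + a (suc m) * 𝐜 0
    ≡⟨ cong (λ j → sumTo m (λ i → a i * 𝐜 (suc m ∸ i)) + a (suc m) * 𝐜 j) (n∸n≡0 m) ⟨
  (a ⊞ 𝐜) (suc m) ∎
  where
    all-but-last : a m ≡ sumTo m (λ i → a i * 𝐜 (suc m ∸ i))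
    all-but-last = sym (begin
      sumTo m (λ i → a i * 𝐜 (suc m ∸ i))
        ≡⟨ sumTo-last m (λ i i<m → trans (cong (a i *_) (trans (𝐜-suc-∸ (<⇒≤ i<m))
                                                                 (𝐜-suc-pos (m<n⇒0<n∸m i<m))))
                                         (*-zeroʳ (a i))) ⟩
      a m * 𝐜 (suc m ∸ m)
        ≡⟨ cong (a m *_) (trans (𝐜-suc-∸ (≤-refl {m})) (cong (𝐜 ∘ suc) (n∸n≡0 m))) ⟩
      a m * 1
        ≡⟨ *-identityʳ (a m) ⟩
      a m ∎)

R-upper : (b : Seq) {i j : ℕ} → i ≤ j → R b i j ≡ b (j ∸ i)
R-upper b {i} {j} i≤j with i ≤? j
... | yes _   = refl
... | no i≰j = contradiction i≤j i≰j

·R≗⊞ : (a b : Seq) (j : ℕ) → (a · R b) j ≡ (a ⊞ b) j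
·R≗⊞ a b j = sumTo-cong j (λ i i≤j → cong (a i *_) (R-upper b i≤j))

mainTheorem15 : ((k : ℕ) → ((q : ℕ) → con (cad⁺ k) q ≡ cad k q)
                    × ((q : ℕ) → cad k q ≡ (cad⁺ k ⊞ 𝐜) q)
                    × ((q : ℕ) → cad k q ≡ (cad⁺ k · R 𝐜) q))
                × ((k q : ℕ) → cad k q ≡ (cad⁺ ·ₘ R 𝐜) k q)
mainTheorem15 = (λ k → con-cad⁺ k , cad≡⊞𝐜 k , cad≡·R𝐜 k) , cad≡·R𝐜
  where
    cad≡⊞𝐜 : (k q : ℕ) → cad k q ≡ (cad⁺ k ⊞ 𝐜) q
    cad≡⊞𝐜 k q = trans (sym (con-cad⁺ k q)) (con≗⊞𝐜 (cad⁺ k) q)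

    cad≡·R𝐜 : (k q : ℕ) → cad k q ≡ (cad⁺ k · R 𝐜) q
    cad≡·R𝐜 k q = trans (cad≡⊞𝐜 k q) (sym (·R≗⊞ (cad⁺ k) 𝐜 q))
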